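{- If $G$ is a finite simple graph with $n$ vertices, then $\mathrm{MOF}(G) \leq n - \mathrm{mim}(G)$.
   Context: An orientation $D$ of a simple graph $G$ assigns to each edge exactly one direction; if $(u,v)$ is an arc, $v$ is an out-neighbor of $u$. Oriented $1$-forcing: starting from a nonempty set $S$ of colored vertices, repeatedly, any colored vertex with at most one non-colored out-neighbor forces that out-neighbor to become colored (all forcings in a step simultaneous), until no change occurs; $S$ is a forcing set if all vertices end up colored. $F(D)$ is the minimum size of a forcing set of $D$, and $\mathrm{MOF}(G)$ is the maximum of $F(D)$ over all orientations $D$ of $G$. An induced matching is a matching $M$ such that no two edges of $M$ are joined by an edge of $G$; $\mathrm{mim}(G)$ is the maximum number of edges in an induced matching of $G$. -}

module Defs where

open import Data.Nat using (ℕ; zero; suc; _+_; _≤_)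
open import Data.Fin using (Fin; _≟_)
open import Data.Fin.Subset using (Subset; ∣_∣; Nonempty)
open import Data.Bool using (Bool; true; false; _∧_; _∨_; not)
open import Data.Vec using (lookup)
open import Data.Product using (Σ; ∃; _×_; _,_; proj₁; proj₂)
open import Relation.Binary.PropositionalEquality using (_≡_; _≢_)
open import Data.Sum using (_⊎_)
open import Relation.Nullary using (¬_; does)

anyFin : ∀ {n} → (Fin n → Bool) → Bool
anyFin {zero}  f = false
anyFin {suc n} f = f Fin.zero ∨ anyFin {n} (λ i → f (Fin.suc i))

allFin : ∀ {n} → (Fin n → Bool) → Bool
allFin {zero}  f = true
allFin {suc n} f = f Fin.zero ∧ allFin {n} (λ i → f (Fin.suc i))

record Graph (n : ℕ) : Set where
  field
    adj    : Fin n → Fin n → Bool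
    sym    : ∀ u v → adj u v ≡ adj v u
    irrefl : ∀ v → adj v v ≡ false
open Graph public

record Orientation {n : ℕ} (G : Graph n) : Set where
  field
    arc       : Fin n → Fin n → Bool
    arc⇒edge  : ∀ u v → arc u v ≡ true → adj G u v ≡ true
    edge⇒one  : ∀ u v → adj G u v ≡ true → (arc u v ≡ true × arc v u ≡ false)
                                          ⊎ (arc u v ≡ false × arc v u ≡ true)
open Orientation public

forceStep : ∀ {n} {G : Graph n} → Orientation G → (Fin n → Bool) → (Fin n → Bool)
forceStep D c v =
  c v ∨ anyFin (λ u → c u ∧ arc D u v ∧
                   allFin (λ w → not (arc D u w) ∨ c w ∨ does (w ≟ v)))

colouredAfter : ∀ {n} {G : Graph n} → Orientation G → Subset n → ℕ → (Fin n → Bool)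
colouredAfter D S zero    = λ v → lookup S v
colouredAfter D S (suc k) = forceStep D (colouredAfter D S k)

-- S is a forcing set: nonempty, and the process eventually colours every vertex
-- (the process is monotone, so this is the same as the final stable set being all of V).
IsForcingSet : ∀ {n} {G : Graph n} → Orientation G → Subset n → Set
IsForcingSet {n} D S = Nonempty S × Σ ℕ (λ k → ∀ v → colouredAfter D S k v ≡ true)

record InducedMatching {n : ℕ} (G : Graph n) (m : ℕ) : Set where
  field
    ends      : Fin m → Bool → Fin n
    isEdge    : ∀ i → adj G (ends i false) (ends i true) ≡ true
    disjoint  : ∀ i j → i ≢ j → ∀ s t → ends i s ≢ ends j t
    induced   : ∀ i j → i ≢ j → ∀ s t → adj G (ends i s) (ends j t) ≡ false
open InducedMatching public

-- D directs each edge of the induced matching from a tail to a head; colour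
-- every vertex except the m heads. A tail is then coloured, and its only
-- uncoloured out-neighbour is its own head: an arc to another head would be an
-- edge between two matching edges, which inducedness forbids. So every head is
-- forced in the first step, and the n − m coloured vertices form a forcing set.
module Submission where

open import Defs
open import Data.Nat using (ℕ; zero; suc; _+_; _≤_)
open import Data.Nat.Properties using (≤-refl; +-identityʳ; +-suc; +-monoˡ-≤; module ≤-Reasoning)
open import Data.Fin using (Fin; _≟_) renaming (zero to fzero; suc to fsuc)
open import Data.Fin.Subset using (Subset; ∣_∣; _∈_; _∉_; _-_; ⊤; Nonempty)
open import Data.Fin.Subset.Properties using (∈⊤; ∣⊤∣≡n; _∈?_; x∈p∧x≢y⇒x∈p-y; x∈p⇒∣p-x∣<∣p∣)
open import Data.Fin.Properties using (suc-injective)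
open import Data.Vec using (lookup)
open import Data.Vec.Properties using ([]=⇒lookup)
open import Data.Bool using (Bool; true; false; _∧_; _∨_; not)
open import Data.Bool.Properties using (∨-zeroʳ)
open import Data.Product using (Σ; ∃; _×_; _,_; proj₁; proj₂)
open import Data.Sum using (inj₁; inj₂)
open import Function using (_∘_)
open import Function.Definitions using (Injective)
open import Relation.Nullary using (yes; no; does; contradiction)
open import Relation.Binary.PropositionalEquality using (_≡_; _≢_; refl; trans; cong) renaming (sym to ≡-sym)

anyFin-intro : ∀ {n} (f : Fin n → Bool) (u : Fin n) → f u ≡ true → anyFin f ≡ true
anyFin-intro f fzero    fu rewrite fu = refl
anyFin-intro f (fsuc u) fu rewrite anyFin-intro (f ∘ fsuc) u fu = ∨-zeroʳ (f fzero)

allFin-intro : ∀ {n} (f : Fin n → Bool) → (∀ w → f w ≡ true) → allFin f ≡ true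
allFin-intro {zero}  f _ = refl
allFin-intro {suc n} f p rewrite p fzero = allFin-intro (f ∘ fsuc) (p ∘ fsuc)

module _ {n} {G : Graph n} (D : Orientation G) (c : Fin n → Bool) where

  forceStep-keeps : ∀ {v} → c v ≡ true → forceStep D c v ≡ true
  forceStep-keeps cv rewrite cv = refl

  forceStep-forces : ∀ {u v} → c u ≡ true → arc D u v ≡ true →
                     (∀ w → arc D u w ≡ true → w ≢ v → c w ≡ true) →
                     forceStep D c v ≡ true
  forceStep-forces {u} {v} cu uv others =
    trans (cong (c v ∨_) (anyFin-intro _ u forces)) (∨-zeroʳ (c v))
    where

    restColoured : ∀ w → (not (arc D u w) ∨ c w ∨ does (w ≟ v)) ≡ true
    restColoured w with arc D u w in uw | w ≟ v
    ... | false | _       = refl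
    ... | true  | yes _   = ∨-zeroʳ (c w)
    ... | true  | no w≢v  rewrite others w uw w≢v = refl

    forces : (c u ∧ arc D u v ∧ allFin (λ w → not (arc D u w) ∨ c w ∨ does (w ≟ v))) ≡ true
    forces rewrite cu | uv = allFin-intro _ restColoured

imageᶜ : ∀ {m n} → (Fin m → Fin n) → Subset n
imageᶜ {zero}  h = ⊤
imageᶜ {suc m} h = imageᶜ (h ∘ fsuc) - h fzero

∈imageᶜ⁺ : ∀ {m n} (h : Fin m → Fin n) {v} → (∀ i → h i ≢ v) → v ∈ imageᶜ h
∈imageᶜ⁺ {zero}  h _   = ∈⊤
∈imageᶜ⁺ {suc m} h h≢v = x∈p∧x≢y⇒x∈p-y (∈imageᶜ⁺ (h ∘ fsuc) (h≢v ∘ fsuc)) (h≢v fzero ∘ ≡-sym)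

∉imageᶜ⇒∈image : ∀ {m n} (h : Fin m → Fin n) {v} → v ∉ imageᶜ h → ∃ λ i → h i ≡ v
∉imageᶜ⇒∈image {zero}  h v∉ = contradiction ∈⊤ v∉
∉imageᶜ⇒∈image {suc m} h {v} v∉ with v ≟ h fzero | v ∈? imageᶜ (h ∘ fsuc)
... | yes v≡h0 | _       = fzero , ≡-sym v≡h0
... | no v≢h0  | yes v∈  = contradiction (x∈p∧x≢y⇒x∈p-y v∈ v≢h0) v∉
... | no _     | no v∉′  = let i , hi≡v = ∉imageᶜ⇒∈image (h ∘ fsuc) v∉′ in fsuc i , hi≡v

imageᶜ-nonempty : ∀ {m n} (h : Fin m → Fin n) → Fin n →
                  (Fin m → Nonempty (imageᶜ h)) → Nonempty (imageᶜ h)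
imageᶜ-nonempty {zero}  h v _    = v , ∈⊤
imageᶜ-nonempty {suc m} h _ from = from fzero

∣imageᶜ∣+m≤n : ∀ {m n} (h : Fin m → Fin n) → Injective _≡_ _≡_ h → ∣ imageᶜ h ∣ + m ≤ n
∣imageᶜ∣+m≤n {zero}  {n} h _ rewrite ∣⊤∣≡n n | +-identityʳ n = ≤-refl
∣imageᶜ∣+m≤n {suc m} {n} h inj = begin
  ∣ imageᶜ h ∣ + suc m             ≡⟨ +-suc ∣ imageᶜ h ∣ m ⟩
  suc ∣ imageᶜ h ∣ + m             ≤⟨ +-monoˡ-≤ m (x∈p⇒∣p-x∣<∣p∣ h0∈rest) ⟩
  ∣ imageᶜ (h ∘ fsuc) ∣ + m        ≤⟨ ∣imageᶜ∣+m≤n (h ∘ fsuc) (suc-injective ∘ inj) ⟩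
  n                                ∎
  where
  open ≤-Reasoning
  h0∈rest : h fzero ∈ imageᶜ (h ∘ fsuc)
  h0∈rest = ∈imageᶜ⁺ (h ∘ fsuc) (λ i hi≡h0 → contradiction (inj hi≡h0) λ ())

edge⇒distinct : ∀ {n} (G : Graph n) {u v} → adj G u v ≡ true → u ≢ v
edge⇒distinct G {u} uv refl with trans (≡-sym uv) (irrefl G u)
... | ()

module TailsAndHeads {n} {G : Graph n} (D : Orientation G) {m} (M : InducedMatching G m) where

  private
    direction : ∀ i → Σ Bool λ s → arc D (ends M i s) (ends M i (not s)) ≡ true
    direction i with edge⇒one D _ _ (isEdge M i)
    ... | inj₁ (forward , _)  = false , forward
    ... | inj₂ (_ , backward) = true , backward

  tail head : Fin m → Fin n
  tail i = ends M i (proj₁ (direction i))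
  head i = ends M i (not (proj₁ (direction i)))

  tail→head : ∀ i → arc D (tail i) (head i) ≡ true
  tail→head i = proj₂ (direction i)

  head-injective : Injective _≡_ _≡_ head
  head-injective {i} {j} hi≡hj with i ≟ j
  ... | yes i≡j = i≡j
  ... | no i≢j  = contradiction hi≡hj (disjoint M i j i≢j _ _)

  tail↛otherHead : ∀ {i j} → i ≢ j → arc D (tail i) (head j) ≢ true
  tail↛otherHead {i} {j} i≢j a with trans (≡-sym (arc⇒edge D _ _ a)) (induced M i j i≢j _ _)
  ... | ()

  tail≢head : ∀ i j → tail i ≢ head j
  tail≢head i j with i ≟ j
  ... | yes refl = edge⇒distinct G (arc⇒edge D _ _ (tail→head i))
  ... | no i≢j   = disjoint M i j i≢j _ _

  headless : Subset n
  headless = imageᶜ head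

  tail∈headless : ∀ i → tail i ∈ headless
  tail∈headless i = ∈imageᶜ⁺ head (λ j hj≡ti → tail≢head i j (≡-sym hj≡ti))

  outNeighbour∈headless : ∀ {i w} → arc D (tail i) w ≡ true → w ≢ head i → w ∈ headless
  outNeighbour∈headless {i} {w} tw w≢hi = ∈imageᶜ⁺ head notHead
    where
    notHead : ∀ j → head j ≢ w
    notHead j refl with i ≟ j
    ... | yes refl = w≢hi refl
    ... | no i≢j   = tail↛otherHead i≢j tw

  headless-forces-all : ∀ v → forceStep D (lookup headless) v ≡ true
  headless-forces-all v with v ∈? headless
  ... | yes v∈ = forceStep-keeps D (lookup headless) ([]=⇒lookup v∈)
  ... | no v∉ with ∉imageᶜ⇒∈image head v∉
  ...   | i , refl =
    forceStep-forces D (lookup headless) ([]=⇒lookup (tail∈headless i)) (tail→head i)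
      (λ w tw w≢hi → []=⇒lookup (outNeighbour∈headless tw w≢hi))

corollary3p21 : (n : ℕ) → 1 ≤ n → (G : Graph n) (D : Orientation G) (m : ℕ) →
    InducedMatching G m →
    Σ (Subset n) (λ S → IsForcingSet D S × ∣ S ∣ + m ≤ n)
corollary3p21 (suc n) _ G D m M =
  headless , (nonempty , 1 , headless-forces-all) , ∣imageᶜ∣+m≤n head head-injective
  where
  open TailsAndHeads D M
  nonempty : Nonempty headless
  nonempty = imageᶜ-nonempty head fzero (λ i → tail i , tail∈headless i)
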